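{- If $G$ is a finite simple graph and $k\ge 2$ is an integer, then $d_R^k(G)=2$ if and only if $G$ is trivial (has exactly one vertex).
   Context: A Roman $k$-dominating function (RkDF) on a graph $G$ is a map $f:V(G)\to\{0,1,2\}$ such that every vertex $v$ with $f(v)=0$ has at least $k$ neighbors $u$ with $f(u)=2$. A set $\{f_1,\ldots,f_d\}$ of pairwise distinct RkDFs on $G$ with $\sum_{i=1}^d f_i(v)\le 2k$ for every $v\in V(G)$ is a Roman $(k,k)$-dominating family on $G$; the maximum number of functions in such a family is the Roman $(k,k)$-domatic number $d_R^k(G)$. -}

module Defs where

open import Data.Nat using (ℕ; zero; suc; _+_; _*_; _≤_)
open import Data.Fin using (Fin; zero; suc; toℕ)
open import Data.Bool using (Bool; true; false; if_then_else_; T)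
open import Data.Product using (Σ; _×_; ∃)
open import Relation.Binary.PropositionalEquality using (_≡_; _≢_)
open import Relation.Nullary using (¬_; does)
open import Data.Fin using (_≟_)

record Graph (n : ℕ) : Set where
  field
    adj   : Fin n → Fin n → Bool
    sym   : ∀ u v → adj u v ≡ adj v u
    irrefl : ∀ v → adj v v ≡ false
open Graph public

count : {n : ℕ} → (Fin n → Bool) → ℕ
count {zero}  p = 0
count {suc n} p = (if p zero then 1 else 0) + count (λ i → p (suc i))

sumFin : (d : ℕ) → (Fin d → ℕ) → ℕ
sumFin zero    g = 0
sumFin (suc d) g = g zero + sumFin d (λ i → g (suc i))

-- a labelling V(G) → {0,1,2}, encoded as Fin 3 (value = toℕ)
Labelling : ℕ → Set
Labelling n = Fin n → Fin 3

isTwo : Fin 3 → Bool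
isTwo x = does (x ≟ suc (suc zero))

twoNeighbours : {n : ℕ} → Graph n → Labelling n → Fin n → ℕ
twoNeighbours G f v = count (λ u → if adj G v u then isTwo (f u) else false)

IsRkDF : {n : ℕ} → Graph n → ℕ → Labelling n → Set
IsRkDF G k f = ∀ v → f v ≡ zero → k ≤ twoNeighbours G f v

IsRkkFamily : {n : ℕ} → Graph n → ℕ → (d : ℕ) → (Fin d → Labelling _) → Set
IsRkkFamily {n} G k d fs =
  (∀ i → IsRkDF G k (fs i))
  × (∀ i j → i ≢ j → ¬ (∀ v → fs i v ≡ fs j v))
  × (∀ (v : Fin n) → sumFin d (λ i → toℕ (fs i v)) ≤ 2 * k)

HasRkkFamily : {n : ℕ} → Graph n → ℕ → ℕ → Set
HasRkkFamily {n} G k d = Σ (Fin d → Labelling n) (IsRkkFamily G k d)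

RomanKKDomatic≡ : {n : ℕ} → Graph n → ℕ → ℕ → Set
RomanKKDomatic≡ G k m = HasRkkFamily G k m × (∀ d → HasRkkFamily G k d → d ≤ m)

module Submission where

-- The argument only uses labellings without the value 0: such a
-- labelling is vacuously a Roman k-dominating function, whatever the graph.
--
--  * Trivial graph, upper bound: its single vertex has no neighbours, so for
--    k ≥ 1 every RkDF gives it the value 1 or 2; a labelling of one vertex is
--    determined by that value, so a family of distinct RkDFs has at most 2
--    members (pigeonhole, via injectivity into Fin 2).
--  * Trivial graph, lower bound: the constant labellings 1 and 2 form a
--    family (weight 3 ≤ 2k).
--  * At least two vertices: the all-ones labelling together with the two
--    labellings raising vertex 0, resp. vertex 1, to 2 form a family of size
--    3 (weight ≤ 4 ≤ 2k), so d_R^k ≠ 2.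
--  * Empty graph: there is only one labelling, so no family of size 2.
-- The main theorem combines these four facts by a case split on n.

open import Defs
open import Data.Nat using (ℕ; zero; suc; _≤_; _*_; z≤n; s≤s)
open import Data.Nat.Properties using (≤-trans; *-monoʳ-≤)
open import Data.Fin using (Fin; zero; suc; toℕ; _≟_)
open import Data.Fin.Properties using (injective⇒≤)
open import Data.Product using (_×_; _,_)
open import Data.Empty using (⊥-elim)
open import Function.Definitions using (Injective)
open import Relation.Nullary using (¬_)
open import Relation.Nullary.Decidable using (decidable-stable)
open import Relation.Binary.PropositionalEquality using (_≡_; _≢_; refl; cong; subst)

one two : Fin 3
one = suc zero
two = suc (suc zero)

ZeroFree : {n : ℕ} → Labelling n → Set
ZeroFree f = ∀ v → f v ≢ zero

zeroFree⇒RkDF : {n : ℕ} (G : Graph n) (k : ℕ) {f : Labelling n} →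
                ZeroFree f → IsRkDF G k f
zeroFree⇒RkDF G k zf v f≡0 = ⊥-elim (zf v f≡0)

differAt : {n : ℕ} {f g : Labelling n} (v : Fin n) → f v ≢ g v →
           ¬ (∀ u → f u ≡ g u)
differAt v f≢g agree = f≢g (agree v)

four≤2k : {k : ℕ} → 2 ≤ k → 4 ≤ 2 * k
four≤2k hk = *-monoʳ-≤ 2 hk

trivialNoTwoNeighbours : (G : Graph 1) (f : Labelling 1) (v : Fin 1) →
                         twoNeighbours G f v ≡ 0
trivialNoTwoNeighbours G f zero rewrite irrefl G zero = refl

trivialRkDF⇒zeroFree : (G : Graph 1) {k : ℕ} → 1 ≤ k → {f : Labelling 1} →
                       IsRkDF G k f → ZeroFree f
trivialRkDF⇒zeroFree G {k} hk {f} rk v f≡0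
  with ≤-trans hk (subst (k ≤_) (trivialNoTwoNeighbours G f v) (rk v f≡0))
... | ()

positiveLabel : (x : Fin 3) → x ≢ zero → Fin 2
positiveLabel zero    x≢0 = ⊥-elim (x≢0 refl)
positiveLabel (suc x) _   = x

positiveLabel-injective : (x y : Fin 3) (x≢0 : x ≢ zero) (y≢0 : y ≢ zero) →
                          positiveLabel x x≢0 ≡ positiveLabel y y≢0 → x ≡ y
positiveLabel-injective zero    _       x≢0 _   _  = ⊥-elim (x≢0 refl)
positiveLabel-injective (suc x) zero    _   y≢0 _  = ⊥-elim (y≢0 refl)
positiveLabel-injective (suc x) (suc y) _   _   eq = cong suc eq

-- Upper bound for the trivial graph: distinct RkDFs are determined by their
-- nonzero value at the single vertex, so there are at most two of them.
trivialFamilyBound : (G : Graph 1) {k : ℕ} → 1 ≤ k → (d : ℕ) →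
                     HasRkkFamily G k d → d ≤ 2
trivialFamilyBound G hk d (fs , rk , distinct , _) = injective⇒≤ valueInjective
  where
  zeroFree : ∀ i → ZeroFree (fs i)
  zeroFree i = trivialRkDF⇒zeroFree G hk (rk i)

  value : Fin d → Fin 2
  value i = positiveLabel (fs i zero) (zeroFree i zero)

  sameAt0⇒agree : ∀ i j → fs i zero ≡ fs j zero → ∀ u → fs i u ≡ fs j u
  sameAt0⇒agree i j eq zero = eq

  valueInjective : Injective _≡_ _≡_ value
  valueInjective {i} {j} eq = decidable-stable (i ≟ j) λ i≢j →
    distinct i j i≢j (sameAt0⇒agree i j
      (positiveLabel-injective _ _ (zeroFree i zero) (zeroFree j zero) eq))

trivialFamilyOfTwo : (G : Graph 1) {k : ℕ} → 2 ≤ k → HasRkkFamily G k 2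
trivialFamilyOfTwo G {k} hk = fs , (λ i → zeroFree⇒RkDF G k (zeroFree i)) , distinct , weight
  where
  fs : Fin 2 → Labelling 1
  fs zero       _ = one
  fs (suc zero) _ = two

  zeroFree : ∀ i → ZeroFree (fs i)
  zeroFree zero       _ ()
  zeroFree (suc zero) _ ()

  distinct : ∀ i j → i ≢ j → ¬ (∀ v → fs i v ≡ fs j v)
  distinct zero       zero       i≢j = ⊥-elim (i≢j refl)
  distinct zero       (suc zero) _   = differAt zero λ ()
  distinct (suc zero) zero       _   = differAt zero λ ()
  distinct (suc zero) (suc zero) i≢j = ⊥-elim (i≢j refl)

  weight : ∀ v → sumFin 2 (λ i → toℕ (fs i v)) ≤ 2 * k
  weight zero = ≤-trans (s≤s (s≤s (s≤s z≤n))) (four≤2k hk)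

nontrivialFamilyOfThree : {m : ℕ} (G : Graph (suc (suc m))) {k : ℕ} → 2 ≤ k →
                          HasRkkFamily G k 3
nontrivialFamilyOfThree {m} G {k} hk =
  fs , (λ i → zeroFree⇒RkDF G k (zeroFree i)) , distinct , weight
  where
  fs : Fin 3 → Labelling (suc (suc m))
  fs zero             _                = one
  fs (suc zero)       zero             = two
  fs (suc zero)       (suc _)          = one
  fs (suc (suc zero)) zero             = one
  fs (suc (suc zero)) (suc zero)       = two
  fs (suc (suc zero)) (suc (suc _))    = one

  zeroFree : ∀ i → ZeroFree (fs i)
  zeroFree zero             _             ()
  zeroFree (suc zero)       zero          ()
  zeroFree (suc zero)       (suc _)       ()
  zeroFree (suc (suc zero)) zero          ()
  zeroFree (suc (suc zero)) (suc zero)    ()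
  zeroFree (suc (suc zero)) (suc (suc _)) ()

  distinct : ∀ i j → i ≢ j → ¬ (∀ v → fs i v ≡ fs j v)
  distinct zero             zero             i≢j = ⊥-elim (i≢j refl)
  distinct zero             (suc zero)       _   = differAt zero λ ()
  distinct zero             (suc (suc zero)) _   = differAt (suc zero) λ ()
  distinct (suc zero)       zero             _   = differAt zero λ ()
  distinct (suc zero)       (suc zero)       i≢j = ⊥-elim (i≢j refl)
  distinct (suc zero)       (suc (suc zero)) _   = differAt zero λ ()
  distinct (suc (suc zero)) zero             _   = differAt (suc zero) λ ()
  distinct (suc (suc zero)) (suc zero)       _   = differAt zero λ ()
  distinct (suc (suc zero)) (suc (suc zero)) i≢j = ⊥-elim (i≢j refl)

  weight : ∀ v → sumFin 3 (λ i → toℕ (fs i v)) ≤ 2 * k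
  weight zero          = four≤2k hk
  weight (suc zero)    = four≤2k hk
  weight (suc (suc v)) = ≤-trans (s≤s (s≤s (s≤s z≤n))) (four≤2k hk)

emptyNoFamilyOfTwo : (G : Graph 0) (k : ℕ) → ¬ HasRkkFamily G k 2
emptyNoFamilyOfTwo G k (fs , _ , distinct , _) = distinct zero (suc zero) (λ ()) λ ()

mainTheorem15 : (n : ℕ) (G : Graph n) (k : ℕ) → 2 ≤ k →
                  ((RomanKKDomatic≡ G k 2 → n ≡ 1) × (n ≡ 1 → RomanKKDomatic≡ G k 2))
mainTheorem15 n G k hk = domatic2⇒trivial n G , trivial⇒domatic2 n G
  where
  domatic2⇒trivial : (n : ℕ) (G : Graph n) → RomanKKDomatic≡ G k 2 → n ≡ 1
  domatic2⇒trivial zero          G (family , _) = ⊥-elim (emptyNoFamilyOfTwo G k family)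
  domatic2⇒trivial (suc zero)    G _            = refl
  domatic2⇒trivial (suc (suc m)) G (_ , atMost2)
    with atMost2 3 (nontrivialFamilyOfThree G hk)
  ... | s≤s (s≤s ())

  trivial⇒domatic2 : (n : ℕ) (G : Graph n) → n ≡ 1 → RomanKKDomatic≡ G k 2
  trivial⇒domatic2 .1 G refl =
    trivialFamilyOfTwo G hk , trivialFamilyBound G (≤-trans (s≤s z≤n) hk)
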